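{- If $n$ is a Zumkeller number, then $H(n)\leq \tau(n)/2$. More generally, if $n$ is a $k$-layered number for a positive integer $k$, then $H(n)\leq \tau(n)/k$.
   Context: $\tau(n)$ is the number of positive divisors of $n$, $\sigma(n)$ their sum, and $H(n)=\dfrac{n\tau(n)}{\sigma(n)}$ is the harmonic mean of the divisors of $n$. A positive integer $n$ is $k$-layered if its set of positive divisors can be partitioned into $k$ disjoint subsets with equal sums; Zumkeller numbers are the $2$-layered numbers. -}

module Defs where

open import Data.Nat using (ℕ; zero; suc; _+_; _*_; NonZero; _≟_)
open import Data.Nat.Divisibility using (_∣_; _∣?_)
open import Data.List using (List; []; _∷_; filter; length; applyUpTo)
open import Data.Nat.ListAction using (sum)
open import Data.List.Properties using (filter-accept)
open import Data.Fin using (Fin; toℕ)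
open import Data.Integer using (+_)
open import Data.Rational using (ℚ; _/_)
open import Data.Product using (Σ)
open import Data.Nat.Divisibility using (1∣_)
open import Relation.Binary.PropositionalEquality using (_≡_)

divisors : ℕ → List ℕ
divisors n = filter (_∣? n) (applyUpTo suc n)

τ : ℕ → ℕ
τ n = length (divisors n)

σ : ℕ → ℕ
σ n = sum (divisors n)

σ-nonZero : ∀ m → NonZero (σ (suc m))
σ-nonZero m rewrite filter-accept (_∣? suc m) {x = 1} {xs = applyUpTo (λ i → suc (suc i)) m} (1∣ suc m) = _

-- harmonic mean of the divisors: H(n) = n τ(n) / σ(n), for n ≥ 1
H : (n : ℕ) → .{{NonZero n}} → ℚ
H (suc m) = (+ (suc m * τ (suc m))) / σ (suc m) where instance _ = σ-nonZero m

-- A partition is given by a class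
-- assignment c : ℕ → Fin k of each divisor; class i is the sublist of
-- divisors d with c d = i; all k class sums coincide.
classSum : ∀ {k} → ℕ → (ℕ → Fin k) → Fin k → ℕ
classSum n c i = sum (filter (λ d → toℕ (c d) ≟ toℕ i) (divisors n))

Layered : ℕ → ℕ → Set
Layered k n = Σ (ℕ → Fin k) λ c → ∀ i j → classSum n c i ≡ classSum n c j

-- Fix a partition of the divisors of n into k classes of common sum S.  The class
-- containing n itself has sum at least n, so σ(n) = k S ≥ k n, which is exactly
-- H(n) = n τ(n) / σ(n) ≤ τ(n) / k after cross-multiplication.
module Submission where

open import Defs
open import Data.Nat using (ℕ; zero; suc; NonZero; _+_; _*_; _≤_; _<?_; _≟_; s≤s)
open import Data.Nat.Properties
open import Algebra.Properties.CommutativeSemigroup +-commutativeSemigroup using (x∙yz≈y∙xz)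
open import Data.Nat.Divisibility using (_∣?_; ∣-refl)
open import Data.Nat.ListAction using (sum)
open import Data.List using ([]; _∷_; filter)
open import Data.List.Properties using (filter-accept; filter-reject; filter-none; filter-all)
open import Data.List.Relation.Unary.All as All using (All)
open import Data.List.Relation.Unary.Any using (here; there)
open import Data.List.Membership.Propositional using (_∈_)
open import Data.List.Membership.Propositional.Properties using (∈-filter⁺; ∈-applyUpTo⁺)
open import Data.Fin using (Fin; toℕ; fromℕ<)
open import Data.Fin.Properties using (toℕ<n; toℕ-fromℕ<)
open import Data.Integer using (+_)
import Data.Integer as ℤ
import Data.Integer.Properties as ℤ
open import Data.Rational using (_/_)
import Data.Rational as ℚ
open import Data.Rational.Properties using (toℚᵘ-cancel-≤; toℚᵘ-fromℚᵘ)
import Data.Rational.Unnormalised as ℚᵘ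
import Data.Rational.Unnormalised.Properties as ℚᵘ
open import Data.Product using (_,_)
open import Relation.Nullary using (yes; no; ¬_; contradiction)
open import Relation.Unary using (Pred; Decidable)
open import Relation.Binary.PropositionalEquality

∈⇒≤sum : ∀ {x xs} → x ∈ xs → x ≤ sum xs
∈⇒≤sum {xs = y ∷ ys} (here refl) = m≤m+n y (sum ys)
∈⇒≤sum {xs = y ∷ ys} (there x∈ys) = ≤-trans (∈⇒≤sum x∈ys) (m≤n+m (sum ys) y)

module _ {ℓ} {P Q R : Pred ℕ ℓ} (P? : Decidable P) (Q? : Decidable Q) (R? : Decidable R)
         (Q⇒P : ∀ {x} → Q x → P x) (R⇒P : ∀ {x} → R x → P x)
         (P∧¬Q⇒R : ∀ {x} → P x → ¬ Q x → R x) (Q⇒¬R : ∀ {x} → Q x → ¬ R x) where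

  sum-filter-disjoint-∪ : ∀ xs → sum (filter P? xs) ≡ sum (filter Q? xs) + sum (filter R? xs)
  sum-filter-disjoint-∪ [] = refl
  sum-filter-disjoint-∪ (x ∷ xs) with Q? x | R? x
  ... | yes q | yes r = contradiction r (Q⇒¬R q)
  ... | yes q | no ¬r
    rewrite filter-accept P? {xs = xs} (Q⇒P q)
    = trans (cong (_+_ x) (sum-filter-disjoint-∪ xs)) (sym (+-assoc x (sum (filter Q? xs)) (sum (filter R? xs))))
  ... | no ¬q | yes r
    rewrite filter-accept P? {xs = xs} (R⇒P r)
    = trans (cong (_+_ x) (sum-filter-disjoint-∪ xs)) (x∙yz≈y∙xz x (sum (filter Q? xs)) (sum (filter R? xs)))
  ... | no ¬q | no ¬r
    rewrite filter-reject P? {xs = xs} (λ p → ¬r (P∧¬Q⇒R p ¬q))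
    = sum-filter-disjoint-∪ xs

sum-filter-<-suc : ∀ (g : ℕ → ℕ) m xs →
  sum (filter (λ d → g d <? suc m) xs) ≡
  sum (filter (λ d → g d <? m) xs) + sum (filter (λ d → g d ≟ m) xs)
sum-filter-<-suc g m = sum-filter-disjoint-∪ (λ d → g d <? suc m) (λ d → g d <? m) (λ d → g d ≟ m)
  m<n⇒m<1+n
  (λ g≡m → s≤s (≤-reflexive g≡m))
  (λ g<1+m g≮m → ≤-antisym (≤-pred g<1+m) (≮⇒≥ g≮m))
  (λ g<m g≡m → <-irrefl g≡m g<m)

sum-filter-<-zero : ∀ (g : ℕ → ℕ) xs → sum (filter (λ d → g d <? 0) xs) ≡ 0
sum-filter-<-zero g xs = cong sum (filter-none (λ d → g d <? 0) {xs} (All.tabulate (λ _ ())))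

module _ {k} n (c : ℕ → Fin k) S (classSum≡S : ∀ i → classSum n c i ≡ S) where

  sum-classes-below : ∀ m → m ≤ k → sum (filter (λ d → toℕ (c d) <? m) (divisors n)) ≡ m * S
  sum-classes-below zero _ = sum-filter-<-zero (λ d → toℕ (c d)) (divisors n)
  sum-classes-below (suc m) m<k = begin
    sum (filter (λ d → toℕ (c d) <? suc m) (divisors n))
      ≡⟨ sum-filter-<-suc (λ d → toℕ (c d)) m (divisors n) ⟩
    sum (filter (λ d → toℕ (c d) <? m) (divisors n)) + sum (filter (λ d → toℕ (c d) ≟ m) (divisors n))
      ≡⟨ cong₂ _+_ (sum-classes-below m (<⇒≤ m<k)) class-m≡S ⟩
    m * S + S
      ≡⟨ +-comm (m * S) S ⟩
    suc m * S ∎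
    where
    open ≡-Reasoning
    class-m≡S : sum (filter (λ d → toℕ (c d) ≟ m) (divisors n)) ≡ S
    class-m≡S = subst (λ j → sum (filter (λ d → toℕ (c d) ≟ j) (divisors n)) ≡ S)
                      (toℕ-fromℕ< m<k) (classSum≡S (fromℕ< m<k))

  σ≡k*classSum : σ n ≡ k * S
  σ≡k*classSum = begin
    σ n ≡⟨ cong sum (filter-all (λ d → toℕ (c d) <? k) {divisors n} (All.tabulate (λ {d} _ → toℕ<n (c d)))) ⟨
    sum (filter (λ d → toℕ (c d) <? k) (divisors n)) ≡⟨ sum-classes-below k ≤-refl ⟩
    k * S ∎
    where open ≡-Reasoning

n∈divisors : ∀ n → .{{NonZero n}} → n ∈ divisors n
n∈divisors (suc m) = ∈-filter⁺ (_∣? suc m) (∈-applyUpTo⁺ suc (n<1+n m)) ∣-refl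

layered⇒k*n≤σ : ∀ k n → .{{NonZero n}} → Layered k n → k * n ≤ σ n
layered⇒k*n≤σ k n (c , sums-equal) = begin
  k * n ≤⟨ *-monoʳ-≤ k n≤S ⟩
  k * S ≡⟨ σ≡k*classSum n c S (λ i → sums-equal i (c n)) ⟨
  σ n   ∎
  where
  open ≤-Reasoning
  S = classSum n c (c n)
  n≤S : n ≤ S
  n≤S = ∈⇒≤sum (∈-filter⁺ (λ d → toℕ (c d) ≟ toℕ (c n)) (n∈divisors n) refl)

-- _/_ divides out the gcd, so compare the unnormalised fractions, whose ≤ is plain cross-multiplication.
/-mono-cross : ∀ a b c d .{{_ : NonZero b}} .{{_ : NonZero d}} →
               a * d ≤ c * b → (+ a / b) ℚ.≤ (+ c / d)
/-mono-cross a (suc b) c (suc d) ad≤cb = toℚᵘ-cancel-≤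
  (ℚᵘ.≤-respʳ-≃ (ℚᵘ.≃-sym (toℚᵘ-fromℚᵘ (ℚᵘ.mkℚᵘ (+ c) d)))
  (ℚᵘ.≤-respˡ-≃ (ℚᵘ.≃-sym (toℚᵘ-fromℚᵘ (ℚᵘ.mkℚᵘ (+ a) b)))
    (ℚᵘ.*≤* (subst₂ ℤ._≤_ (ℤ.pos-* a (suc d)) (ℤ.pos-* c (suc b)) (ℤ.+≤+ ad≤cb)))))

mainTheorem17 : (k n : ℕ) → .{{_ : NonZero k}} → .{{_ : NonZero n}} → Layered k n → H n ℚ.≤ (+ τ n) / k
mainTheorem17 k (suc m) layered =
  /-mono-cross (n * τ n) (σ n) (τ n) k {{σ-nonZero m}} cross
  where
  open ≤-Reasoning
  n = suc m
  cross : n * τ n * k ≤ τ n * σ n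
  cross = begin
    n * τ n * k   ≡⟨ cong (_* k) (*-comm n (τ n)) ⟩
    τ n * n * k   ≡⟨ *-assoc (τ n) n k ⟩
    τ n * (n * k) ≡⟨ cong (τ n *_) (*-comm n k) ⟩
    τ n * (k * n) ≤⟨ *-monoʳ-≤ (τ n) (layered⇒k*n≤σ k n layered) ⟩
    τ n * σ n     ∎
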